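{- Let $G=(V,E)$ satisfy the standing assumptions, have highway dimension at most $h$, and let $U$ be its maximum edge weight. There is a constant $0<c_{vc}<1$ depending only on $h$ such that for every valid hierarchy of $G$ and every integer $i\ge\log_8 U+1$, $|BC[i]|\le c_{vc}\,|BC[i-1]|$.
   Context: Standing assumptions: $G$ is a finite connected undirected graph, edge weights at least $1$, shortest paths unique ($p(u,w)$, length $d(u,w)$), every edge is the shortest path between its endpoints. $B(v,r)=\{v': d(v,v')\le r\}$; $\mathrm{maxedge}(p)$ is the maximum edge weight on $p$. Highway dimension: an $r$-witness of a shortest path $p$ from $u$ to $w$ is a shortest path $p'$ of length at least $r$ containing $p$, with endpoints $u$ or a neighbor of $u$, and $w$ or a neighbor of $w$; $p$ is $r$-significant if it has one; $d(v,q)$ is the distance from $v$ to the nearest vertex of $q$; $S(v,r)$ is the set of $r$-significant paths with an $r$-witness $p'$ with $d(v,p')\le 2r$; the highway dimension is the least $h$ such that for all $r>0,v$ some $C\subseteq V$, $|C|\le h$, meets every path of $S(v,r)$. Shortcut graph $G(C,r)$: vertex set $C$, edge $\{v_1,v_2\}$ of weight $d(v_1,v_2)$ iff $d(v_1,v_2)\le r$ and $p(v_1,v_2)$ contains no element of $C$ besides $v_1,v_2$. Hierarchy: $E[i]$ ($i\ge -1$) is the set of edges of weight in $(8^{i-1},8^i]$, $E[\ge i]=\bigcup_{j\ge i}E[j]$. $C'[-1]=\emptyset$, $G[-1]$ empty; $C[i]=C'[i]\cup V(E[\ge i])$ for $i\ge -1$; $G[i]=G(C[i],8^i)$ for $i\ge0$.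 For $i\ge0$ a valid $C'[i]$ is obtained by: start with $\emptyset$; for each pair $v,v'\in V(G[i-1])$ (arbitrary order) with $d_{G[i-1]}(v,v')\in[\frac34 8^i,8^i]$ and $\mathrm{maxedge}(p_G(v,v'))\le 8^{i-1}$, if $p_{G[i-1]}(v,v')$ has no element of $C'[i]$, add the vertex of $G[i-1]$ on it closest to its midpoint; a valid hierarchy uses a valid $C'[i]$ at each level. $\mathrm{BallCover}(C,r)$ is a minimum-cardinality $C''\subseteq C$ with $C\subseteq\bigcup_{v\in C''}B(v,r)$; $BC[i]=\mathrm{BallCover}(C[i],8^i)$.
   Formalization: The edge weights of $G$ are rational. -}

module Defs where

open import Data.Nat as ℕ using (ℕ; zero; suc; _^_)
open import Data.Integer using (+_)
open import Data.Rational as ℚ using (ℚ; 0ℚ; 1ℚ; ½; _/_; _+_; _-_; _*_)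
open import Data.Fin using (Fin; toℕ)
open import Data.Fin.Subset as Sub using (Subset; ⁅_⁆; _∪_)
open import Data.List as L using (List; []; _∷_; _++_; take; length; allFin; cartesianProduct)
open import Data.List.Membership.Propositional as LM using ()
open import Data.List.Relation.Binary.Permutation.Propositional using (_↭_)
open import Data.Product using (Σ; ∃; _×_; _,_)
open import Data.Sum using (_⊎_)
open import Data.Empty using () renaming (⊥ to Empty)
open import Relation.Nullary using (¬_)
open import Relation.Binary.PropositionalEquality using (_≡_; _≢_)
open import Function.Bundles using (_⇔_)

pow8 : ℕ → ℚ
pow8 i = (+ (8 ^ i)) / 1

-- 8^(i-1) = 8^i / 8  (also meaningful for i = 0, giving 1/8)
pow8prev : ℕ → ℚ
pow8prev i = (+ (8 ^ i)) / 8

threeQuarterPow8 : ℕ → ℚ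
threeQuarterPow8 i = (+ (3 ℕ.* 8 ^ i)) / 4

-- Weighted graphs on vertex set Fin n with rational edge weights.
-- `sp u v` is the (unique) shortest path p(u,v), as a vertex list.

record Graph : Set₁ where
  field
    n   : ℕ
    E   : Fin n → Fin n → Set
    w   : Fin n → Fin n → ℚ         -- weight (relevant on edges only)
    sp  : Fin n → Fin n → List (Fin n)

module _ (G : Graph) where
  open Graph G

  data Walk : Fin n → Fin n → List (Fin n) → Set where
    nil  : ∀ {u} → Walk u u (u ∷ [])
    cons : ∀ {u x v p} → E u x → Walk x v p → Walk u v (u ∷ p)

  plen : List (Fin n) → ℚ
  plen (x ∷ y ∷ r) = w x y + plen (y ∷ r)
  plen _           = 0ℚ

  data AllEdges (P : Fin n → Fin n → Set) : List (Fin n) → Set where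
    []₁ : AllEdges P []
    [-] : ∀ {x} → AllEdges P (x ∷ [])
    _∷ₑ_ : ∀ {x y r} → P x y → AllEdges P (y ∷ r) → AllEdges P (x ∷ y ∷ r)

  IsShortestWalk : Fin n → Fin n → List (Fin n) → Set
  IsShortestWalk u v p = Walk u v p × (∀ q → Walk u v q → plen p ℚ.≤ plen q)

  record Standing : Set where
    field
      E-sym      : ∀ {u v} → E u v → E v u
      E-irrefl   : ∀ {u} → ¬ E u u
      w-sym      : ∀ u v → w u v ≡ w v u
      w-≥1       : ∀ {u v} → E u v → 1ℚ ℚ.≤ w u v
      connected  : ∀ u v → ∃ λ p → Walk u v p
      sp-shortest : ∀ u v → IsShortestWalk u v (sp u v)
      sp-unique  : ∀ u v p → IsShortestWalk u v p → p ≡ sp u v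
      edge-sp    : ∀ {u v} → E u v → sp u v ≡ u ∷ v ∷ []

  dist : Fin n → Fin n → ℚ
  dist u v = plen (sp u v)

  IsMaxEdgeWeight : ℚ → Set
  IsMaxEdgeWeight U =
    (∃ λ u → ∃ λ v → E u v × w u v ≡ U) × (∀ u v → E u v → w u v ℚ.≤ U)

  -- p ∈ S(v,r): p = p(u,w') is r-significant, with an r-witness p' such
  -- that d(v,p') ≤ 2r.
  InS : Fin n → ℚ → List (Fin n) → Set
  InS v r p =
    ∃ λ u → ∃ λ u' → p ≡ sp u u' ×
    ∃ λ a → ∃ λ b →
      (a ≡ u ⊎ E a u) × (b ≡ u' ⊎ E b u') ×
      r ℚ.≤ plen (sp a b) ×
      (∃ λ xs → ∃ λ ys → sp a b ≡ xs ++ p ++ ys) ×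
      (∃ λ y → y LM.∈ sp a b × dist v y ℚ.≤ r + r)

  HighwayDimLE : ℕ → Set
  HighwayDimLE h =
    ∀ (r : ℚ) → 0ℚ ℚ.< r → ∀ (v : Fin n) →
    ∃ λ (C : Subset n) → Sub.∣ C ∣ ℕ.≤ h ×
      (∀ p → InS v r p → ∃ λ x → x Sub.∈ C × x LM.∈ p)

  SEdge : Subset n → ℚ → Fin n → Fin n → Set
  SEdge P r x y =
    x Sub.∈ P × y Sub.∈ P × x ≢ y × dist x y ℚ.≤ r ×
    (∀ z → z LM.∈ sp x y → z Sub.∈ P → z ≡ x ⊎ z ≡ y)

  data SWalk (P : Subset n) (r : ℚ) : Fin n → Fin n → List (Fin n) → Set where
    nil  : ∀ {u} → u Sub.∈ P → SWalk P r u u (u ∷ [])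
    cons : ∀ {u x v p} → SEdge P r u x → SWalk P r x v p → SWalk P r u v (u ∷ p)

  slen : List (Fin n) → ℚ
  slen (x ∷ y ∷ r) = dist x y + slen (y ∷ r)
  slen _           = 0ℚ

  IsShortestSWalk : Subset n → ℚ → Fin n → Fin n → List (Fin n) → Set
  IsShortestSWalk P r u v q =
    SWalk P r u v q × (∀ q' → SWalk P r u v q' → slen q ℚ.≤ slen q')

  -- Construction of C'[i] from G[i-1] = G(P, 8^(i-1)), P = C[i-1]
  -- (P = ∅ for i = 0, i.e. G[-1] empty).

  Qualifies : Subset n → ℕ → Fin n → Fin n → Set
  Qualifies P i v v' =
    v Sub.∈ P × v' Sub.∈ P ×
    (∃ λ q → IsShortestSWalk P (pow8prev i) v v' q ×
             threeQuarterPow8 i ℚ.≤ slen q × slen q ℚ.≤ pow8 i) ×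
    AllEdges (λ a b → w a b ℚ.≤ pow8prev i) (sp v v')

  pos : List (Fin n) → ℕ → ℚ
  pos q k = slen (take (suc k) q)

  ClosestToMid : List (Fin n) → Fin n → Set
  ClosestToMid q x =
    ∃ λ (k : Fin (length q)) → L.lookup q k ≡ x ×
      (∀ (k' : Fin (length q)) →
         ℚ.∣ pos q (toℕ k) - slen q * ½ ∣ ℚ.≤ ℚ.∣ pos q (toℕ k') - slen q * ½ ∣)

  -- Run P i S ps T : processing the pairs ps in order, starting with the
  -- current set S, ends with T.
  data Run (P : Subset n) (i : ℕ) : Subset n → List (Fin n × Fin n) → Subset n → Set where
    done : ∀ {S} → Run P i S [] S
    skip : ∀ {S T v v' ps} → ¬ Qualifies P i v v' →
           Run P i S ps T → Run P i S ((v , v') ∷ ps) T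
    hit  : ∀ {S T v v' ps} q → Qualifies P i v v' →
           IsShortestSWalk P (pow8prev i) v v' q →
           (∃ λ z → z LM.∈ q × z Sub.∈ S) →
           Run P i S ps T → Run P i S ((v , v') ∷ ps) T
    add  : ∀ {S T v v' ps} q x → Qualifies P i v v' →
           IsShortestSWalk P (pow8prev i) v v' q →
           (∀ z → z LM.∈ q → z Sub.∉ S) →
           ClosestToMid q x →
           Run P i (S ∪ ⁅ x ⁆) ps T → Run P i S ((v , v') ∷ ps) T

  allPairs : List (Fin n × Fin n)
  allPairs = cartesianProduct (allFin n) (allFin n)

  ValidC'Level : Subset n → ℕ → Subset n → Set
  ValidC'Level P i S = ∃ λ ord → ord ↭ allPairs × Run P i Sub.⊥ ord S

  prevLevel : (ℕ → Subset n) → ℕ → Subset n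
  prevLevel C zero    = Sub.⊥
  prevLevel C (suc i) = C i

  -- C' i = C'[i], C i = C[i] = C'[i] ∪ V(E[≥ i])
  ValidHierarchy : (ℕ → Subset n) → (ℕ → Subset n) → Set
  ValidHierarchy C' C =
    (∀ i x → (x Sub.∈ C i) ⇔ (x Sub.∈ C' i ⊎ ∃ λ y → E x y × pow8prev i ℚ.< w x y)) ×
    (∀ i → ValidC'Level (prevLevel C i) i (C' i))

  IsBallCover : Subset n → ℚ → Subset n → Set
  IsBallCover C r B = B Sub.⊆ C × (∀ x → x Sub.∈ C → ∃ λ y → y Sub.∈ B × dist y x ℚ.≤ r)

  IsMinBallCover : Subset n → ℚ → Subset n → Set
  IsMinBallCover C r B =
    IsBallCover C r B × (∀ B' → IsBallCover C r B' → Sub.∣ B ∣ ℕ.≤ Sub.∣ B' ∣)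

{-# OPTIONS --safe #-}
-- Let r = 8^(i-1). Since U ≤ r there are no heavy edges at level i, so every x ∈ C[i] was added
-- to C'[i] on a shortest path q of G[i-1] = G(C[i-1], r) of length ≥ (3/4)·8^i = 6r. Walking
-- along q away from x for a length in (2r, 3r] reaches some z ∈ C[i-1]. The centres of x and z
-- in BC[i-1] differ: a common centre y would give, by cutting p(z,y) and p(y,x) at their vertices
-- in C[i-1], a walk in G[i-1] of length ≤ 2r between z and x, shorter than that segment of q.
-- So each x ∈ C[i] has two distinct centres of BC[i-1] within 4r. Scanning C[i] and keeping x
-- only when both its centres are still unused gives a set X covering C[i] within 8r = 8^i with
-- 2|X| ≤ |BC[i-1]|; hence |BC[i]| ≤ |BC[i-1]|/2, and c = ½ works for every h.
module Submission where

open import Defs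
open import Data.Nat using (ℕ; _≤_; _∸_)
open import Data.Integer using (+_)
open import Data.Rational using (ℚ; 0ℚ; 1ℚ; _/_; _*_; _<_) renaming (_≤_ to _≤ℚ_)
open import Data.Fin.Subset using (Subset; ∣_∣)
open import Data.Product using (Σ; _×_)

open import Data.Nat as ℕ using (zero; suc; z≤n; s≤s; _^_)
open import Data.Nat.Tactic.RingSolver using (solve-∀)
import Data.Nat.Properties as ℕP
import Data.Nat.Coprimality as Coprime
import Data.Integer as ℤ
import Data.Integer.Properties as ℤP
open import Data.Rational as ℚ using (½; _+_; mkℚ)
import Data.Rational.Properties as ℚP
import Data.Rational.Unnormalised as ℚᵘ
open import Data.Fin using (Fin) renaming (_≟_ to _≟ᶠ_)
open import Data.Fin.Subset as Sub using (_∈_; _∉_; _⊆_; _∪_; ⁅_⁆; inside; outside)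
open import Data.Fin.Subset.Properties
  using (_∈?_; ∉⊥; ∣⊥∣≡0; ⊥⊆; ∣⁅x⁆∣≡1; p⊆p∪q; q⊆p∪q; x∈p∪q⁻; x∈⁅x⁆; x∈⁅y⁆⇒x≡y; p⊂q⇒∣p∣<∣q∣; p⊆q⇒∣p∣≤∣q∣)
open import Data.List using (List; []; _∷_; _++_; [_]; length; allFin)
open import Data.List.Membership.Propositional using (find; lose) renaming (_∈_ to _∈ₗ_)
open import Data.List.Membership.Propositional.Properties using (∈-∃++; ∈-allFin; ∈-lookup)
open import Data.List.Relation.Unary.Any using (here; there; any?)
open import Data.Vec using ([]; _∷_)
open import Data.Product using (∃; _,_; proj₁; proj₂)
open import Data.Sum using (_⊎_; inj₁; inj₂; [_,_]′)
open import Data.Empty using (⊥; ⊥-elim)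
open import Function using (_∘_; id)
open import Function.Bundles using (Equivalence)
open import Relation.Nullary using (yes; no; ¬?)
open import Relation.Nullary.Decidable using (_×-dec_; toWitness)
open import Relation.Binary.PropositionalEquality hiding ([_])
open import Data.Rational.Solver using (module +-*-Solver)

fromℕ : ℕ → ℚ
fromℕ m = + m / 1

private
  fromℕ≡mkℚ : ∀ m → fromℕ m ≡ mkℚ (+ m) 0 (Coprime.sym (Coprime.1-coprimeTo m))
  fromℕ≡mkℚ m = ℚP.normalize-coprime (Coprime.sym (Coprime.1-coprimeTo m))

fromℕ-+ : ∀ a b → fromℕ (a ℕ.+ b) ≡ fromℕ a + fromℕ b
fromℕ-+ a b rewrite fromℕ≡mkℚ a | fromℕ≡mkℚ b = ℚP./-cong numerators refl
  where
  numerators : + (a ℕ.+ b) ≡ + a ℤ.* + 1 ℤ.+ + b ℤ.* + 1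
  numerators rewrite ℤP.*-identityʳ (+ a) | ℤP.*-identityʳ (+ b) = sym (ℤP.pos-+ a b)

fromℕ-mono-≤ : ∀ {a b} → a ℕ.≤ b → fromℕ a ≤ℚ fromℕ b
fromℕ-mono-≤ {a} {b} a≤b rewrite fromℕ≡mkℚ a | fromℕ≡mkℚ b =
  ℚ.*≤* (ℤP.*-monoʳ-≤-nonNeg (+ 1) (ℤ.+≤+ a≤b))

fromℕ-mono-< : ∀ {a b} → a ℕ.< b → fromℕ a < fromℕ b
fromℕ-mono-< {a} {b} a<b rewrite fromℕ≡mkℚ a | fromℕ≡mkℚ b =
  ℚ.*<* (ℤP.*-monoʳ-<-pos (+ 1) (ℤ.+<+ a<b))

/-cross : ∀ a b c d → a ℕ.* suc d ≡ c ℕ.* suc b → + a / suc b ≡ + c / suc d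
/-cross a b c d eq = ℚP.fromℚᵘ-cong {ℚᵘ.mkℚᵘ (+ a) b} {ℚᵘ.mkℚᵘ (+ c) d} (ℚᵘ.*≡* (begin
  + a ℤ.* + suc d   ≡⟨ ℤP.pos-* a (suc d) ⟨
  + (a ℕ.* suc d)   ≡⟨ cong +_ eq ⟩
  + (c ℕ.* suc b)   ≡⟨ ℤP.pos-* c (suc b) ⟩
  + c ℤ.* + suc b   ∎))
  where open ≡-Reasoning

<⇒≱ : ∀ {p q} → p < q → q ≤ℚ p → ⊥
<⇒≱ p<q q≤p = ℚP.<-irrefl refl (ℚP.<-≤-trans p<q q≤p)

+-nonNeg : ∀ {p q} → 0ℚ ≤ℚ p → 0ℚ ≤ℚ q → 0ℚ ≤ℚ p + q
+-nonNeg p≥0 q≥0 = ℚP.+-mono-≤ p≥0 q≥0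

≤-+ʳ : ∀ p {q} → 0ℚ ≤ℚ q → p ≤ℚ p + q
≤-+ʳ p q≥0 = ℚP.≤-trans (ℚP.≤-reflexive (sym (ℚP.+-identityʳ p))) (ℚP.+-monoʳ-≤ p q≥0)

+-cancelʳ-≤ : ∀ c {a b} → a + c ≤ℚ b + c → a ≤ℚ b
+-cancelʳ-≤ c {a} {b} a+c≤b+c with a ℚP.≤? b
... | yes a≤b = a≤b
... | no a≰b = ⊥-elim (<⇒≱ (ℚP.+-monoˡ-< c (ℚP.≰⇒> a≰b)) a+c≤b+c)

+-cancelˡ-≤ : ∀ c {a b} → c + a ≤ℚ c + b → a ≤ℚ b
+-cancelˡ-≤ c {a} {b} c+a≤c+b = +-cancelʳ-≤ c (subst₂ _≤ℚ_ (ℚP.+-comm c a) (ℚP.+-comm c b) c+a≤c+b)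

<-of-sum : ∀ {a b c d} → c + d < a + b → a ≤ℚ c → d < b
<-of-sum {a} {b} {c} {d} c+d<a+b a≤c with d ℚP.<? b
... | yes d<b = d<b
... | no d≮b  = ⊥-elim (<⇒≱ c+d<a+b (ℚP.+-mono-≤ a≤c (ℚP.≮⇒≥ d≮b)))

length-split : ∀ {A : Set} (pre : List A) z post →
               suc (length (pre ++ z ∷ post)) ≡ length (pre ++ [ z ]) ℕ.+ length (z ∷ post)
length-split []        z post = refl
length-split (_ ∷ pre) z post = cong suc (length-split pre z post)

∣p∪q∣≤∣p∣+∣q∣ : ∀ {m} (p q : Subset m) → ∣ p ∪ q ∣ ℕ.≤ ∣ p ∣ ℕ.+ ∣ q ∣
∣p∪q∣≤∣p∣+∣q∣ []            []            = z≤n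
∣p∪q∣≤∣p∣+∣q∣ (outside ∷ p) (outside ∷ q) = ∣p∪q∣≤∣p∣+∣q∣ p q
∣p∪q∣≤∣p∣+∣q∣ (outside ∷ p) (inside  ∷ q) =
  ℕP.≤-trans (s≤s (∣p∪q∣≤∣p∣+∣q∣ p q)) (ℕP.≤-reflexive (sym (ℕP.+-suc _ _)))
∣p∪q∣≤∣p∣+∣q∣ (inside  ∷ p) (outside ∷ q) = s≤s (∣p∪q∣≤∣p∣+∣q∣ p q)
∣p∪q∣≤∣p∣+∣q∣ (inside  ∷ p) (inside  ∷ q) =
  s≤s (ℕP.≤-trans (ℕP.m≤n⇒m≤1+n (∣p∪q∣≤∣p∣+∣q∣ p q)) (ℕP.≤-reflexive (sym (ℕP.+-suc _ _))))

module _ {n : ℕ} where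

  ∣p∪⁅x⁆∣≤1+∣p∣ : ∀ (p : Subset n) x → ∣ p ∪ ⁅ x ⁆ ∣ ℕ.≤ suc ∣ p ∣
  ∣p∪⁅x⁆∣≤1+∣p∣ p x = ℕP.≤-trans (∣p∪q∣≤∣p∣+∣q∣ p ⁅ x ⁆)
    (ℕP.≤-reflexive (trans (cong (∣ p ∣ ℕ.+_) (∣⁅x⁆∣≡1 x)) (ℕP.+-comm ∣ p ∣ 1)))

  x∉p⇒∣p∣<∣p∪⁅x⁆∣ : ∀ {p : Subset n} {x} → x ∉ p → ∣ p ∣ ℕ.< ∣ p ∪ ⁅ x ⁆ ∣
  x∉p⇒∣p∣<∣p∪⁅x⁆∣ {p} {x} x∉p = p⊂q⇒∣p∣<∣q∣ (p⊆p∪q ⁅ x ⁆ , x , q⊆p∪q p ⁅ x ⁆ (x∈⁅x⁆ x) , x∉p)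

  ∣p∪⁅x⁆∣-double≤ : ∀ {p q : Subset n} {x y₀ y₁} → ∣ p ∣ ℕ.+ ∣ p ∣ ℕ.≤ ∣ q ∣ →
                     y₀ ∉ q → y₁ ∉ q ∪ ⁅ y₀ ⁆ → ∣ p ∪ ⁅ x ⁆ ∣ ℕ.+ ∣ p ∪ ⁅ x ⁆ ∣ ℕ.≤ ∣ (q ∪ ⁅ y₀ ⁆) ∪ ⁅ y₁ ⁆ ∣
  ∣p∪⁅x⁆∣-double≤ {p} {q} {x} {y₀} {y₁} 2∣p∣≤∣q∣ y₀∉q y₁∉q′ = begin
    ∣ p ∪ ⁅ x ⁆ ∣ ℕ.+ ∣ p ∪ ⁅ x ⁆ ∣  ≤⟨ ℕP.+-mono-≤ (∣p∪⁅x⁆∣≤1+∣p∣ p x) (∣p∪⁅x⁆∣≤1+∣p∣ p x) ⟩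
    suc ∣ p ∣ ℕ.+ suc ∣ p ∣          ≡⟨ cong suc (ℕP.+-suc ∣ p ∣ ∣ p ∣) ⟩
    suc (suc (∣ p ∣ ℕ.+ ∣ p ∣))      ≤⟨ s≤s (s≤s 2∣p∣≤∣q∣) ⟩
    suc (suc ∣ q ∣)                  ≤⟨ s≤s (x∉p⇒∣p∣<∣p∪⁅x⁆∣ y₀∉q) ⟩
    suc ∣ q ∪ ⁅ y₀ ⁆ ∣               ≤⟨ x∉p⇒∣p∣<∣p∪⁅x⁆∣ y₁∉q′ ⟩
    ∣ (q ∪ ⁅ y₀ ⁆) ∪ ⁅ y₁ ⁆ ∣        ∎
    where open ℕP.≤-Reasoning

  x∈p∪⁅y⁆⁻ : ∀ {p : Subset n} {x y} → x ∈ p ∪ ⁅ y ⁆ → x ∈ p ⊎ x ≡ y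
  x∈p∪⁅y⁆⁻ {p} {x} {y} x∈ with x∈p∪q⁻ p ⁅ y ⁆ x∈
  ... | inj₁ x∈p   = inj₁ x∈p
  ... | inj₂ x∈⁅y⁆ = inj₂ (x∈⁅y⁆⇒x≡y y x∈⁅y⁆)

  x∈p∪⁅x⁆ : ∀ (p : Subset n) x → x ∈ p ∪ ⁅ x ⁆
  x∈p∪⁅x⁆ p x = q⊆p∪q p ⁅ x ⁆ (x∈⁅x⁆ x)

module _ {n : ℕ} (d : Fin n → Fin n → ℚ) where

  record DoublyCovered (B : Subset n) (R : ℚ) (x : Fin n) : Set where
    constructor doublyCovered
    field
      {y₀ y₁} : Fin n
      y₀∈B    : y₀ ∈ B
      y₁∈B    : y₁ ∈ B
      y₀≢y₁   : y₀ ≢ y₁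
      y₀-near : d y₀ x ≤ℚ R
      y₁-near : d y₁ x ≤ℚ R

module HalfCover {n : ℕ} (d : Fin n → Fin n → ℚ)
  (d-sym : ∀ x y → d x y ≡ d y x) (d-tri : ∀ x y z → d x z ≤ℚ d x y + d y z)
  (A B : Subset n) (R : ℚ) (doubly : ∀ {x} → x ∈ A → DoublyCovered d B R x) where

  record Selection : Set where
    field
      X Y         : Subset n
      X⊆A         : X ⊆ A
      Y⊆B         : Y ⊆ B
      ∣X∣+∣X∣≤∣Y∣ : ∣ X ∣ ℕ.+ ∣ X ∣ ℕ.≤ ∣ Y ∣
      Y-near      : ∀ {y} → y ∈ Y → ∃ λ x → x ∈ X × d y x ≤ℚ R

  open Selection

  CoveredBy : Selection → Fin n → Set
  CoveredBy S x = ∃ λ x′ → x′ ∈ X S × d x′ x ≤ℚ R + R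

  Covers : Selection → List (Fin n) → Set
  Covers S xs = ∀ {x} → x ∈ₗ xs → x ∈ A → CoveredBy S x

  near-via : ∀ {y a b} → d y a ≤ℚ R → d y b ≤ℚ R → d a b ≤ℚ R + R
  near-via {y} {a} {b} y-near-a y-near-b =
    ℚP.≤-trans (d-tri a y b) (ℚP.+-mono-≤ (subst (_≤ℚ R) (d-sym y a) y-near-a) y-near-b)

  via-Y : ∀ {x y} (S : Selection) → y ∈ Y S → d y x ≤ℚ R → CoveredBy S x
  via-Y S y∈Y y-near-x with Y-near S y∈Y
  ... | x′ , x′∈X , y-near-x′ = x′ , x′∈X , near-via y-near-x′ y-near-x

  empty : Selection
  empty = record
    { X = Sub.⊥ ; Y = Sub.⊥ ; X⊆A = ⊥⊆ ; Y⊆B = ⊥⊆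
    ; ∣X∣+∣X∣≤∣Y∣ = ℕP.≤-trans (ℕP.≤-reflexive (cong (λ k → k ℕ.+ k) (∣⊥∣≡0 n))) z≤n
    ; Y-near = λ y∈⊥ → ⊥-elim (∉⊥ y∈⊥) }

  keep : ∀ {x xs} (S : Selection) → Covers S xs → (x ∈ A → CoveredBy S x) → Covers S (x ∷ xs)
  keep S covers covers-x (here refl) = covers-x
  keep S covers covers-x (there x∈) = covers x∈

  extend : ∀ {x xs} (S : Selection) → Covers S xs → x ∈ A → (c : DoublyCovered d B R x) →
           DoublyCovered.y₀ c ∉ Y S → DoublyCovered.y₁ c ∉ Y S → ∃ λ S′ → Covers S′ (x ∷ xs)
  extend {x} S covers x∈A (doublyCovered {y₀} {y₁} y₀∈B y₁∈B y₀≢y₁ y₀-near y₁-near) y₀∉Y y₁∉Y =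
    S′ , λ { (here refl) _ → x , x∈X′ , near-via y₀-near y₀-near
           ; (there z∈) z∈A → let x′ , x′∈X , near = covers z∈ z∈A in x′ , X⊆X′ x′∈X , near }
    where
    X′ Y₀ Y′ : Subset n
    X′ = X S ∪ ⁅ x ⁆
    Y₀ = Y S ∪ ⁅ y₀ ⁆
    Y′ = Y₀ ∪ ⁅ y₁ ⁆
    x∈X′ : x ∈ X′
    x∈X′ = x∈p∪⁅x⁆ (X S) x
    X⊆X′ : X S ⊆ X′
    X⊆X′ = p⊆p∪q ⁅ x ⁆
    y₁∉Y₀ : y₁ ∉ Y₀
    y₁∉Y₀ y₁∈Y₀ = [ y₁∉Y , (λ y₁≡y₀ → y₀≢y₁ (sym y₁≡y₀)) ]′ (x∈p∪⁅y⁆⁻ y₁∈Y₀)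
    S′ : Selection
    S′ = record
      { X = X′ ; Y = Y′
      ; X⊆A = λ z∈X′ → [ X⊆A S , (λ { refl → x∈A }) ]′ (x∈p∪⁅y⁆⁻ z∈X′)
      ; Y⊆B = λ z∈Y′ → [ (λ z∈Y₀ → [ Y⊆B S , (λ { refl → y₀∈B }) ]′ (x∈p∪⁅y⁆⁻ z∈Y₀))
                       , (λ { refl → y₁∈B }) ]′ (x∈p∪⁅y⁆⁻ z∈Y′)
      ; ∣X∣+∣X∣≤∣Y∣ = ∣p∪⁅x⁆∣-double≤ {p = X S} {q = Y S} (∣X∣+∣X∣≤∣Y∣ S) y₀∉Y y₁∉Y₀
      ; Y-near = λ z∈Y′ → [ (λ z∈Y₀ → [ old , (λ { refl → x , x∈X′ , y₀-near }) ]′ (x∈p∪⁅y⁆⁻ z∈Y₀))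
                          , (λ { refl → x , x∈X′ , y₁-near }) ]′ (x∈p∪⁅y⁆⁻ z∈Y′) }
      where
      old : ∀ {y} → y ∈ Y S → ∃ λ x′ → x′ ∈ X′ × d y x′ ≤ℚ R
      old y∈Y = let x′ , x′∈X , near = Y-near S y∈Y in x′ , X⊆X′ x′∈X , near

  select : ∀ xs → ∃ λ S → Covers S xs
  select []       = empty , λ ()
  select (x ∷ xs) with select xs | x ∈? A
  ... | S , covers | no x∉A = S , keep S covers (λ x∈A → ⊥-elim (x∉A x∈A))
  ... | S , covers | yes x∈A with doubly x∈A
  ...   | c with DoublyCovered.y₀ c ∈? Y S | DoublyCovered.y₁ c ∈? Y S
  ...     | yes y₀∈Y | _        = S , keep S covers (λ _ → via-Y S y₀∈Y (DoublyCovered.y₀-near c))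
  ...     | no _     | yes y₁∈Y = S , keep S covers (λ _ → via-Y S y₁∈Y (DoublyCovered.y₁-near c))
  ...     | no y₀∉Y  | no y₁∉Y  = extend S covers x∈A c y₀∉Y y₁∉Y

  half-cover : ∃ λ X → X ⊆ A × (∀ x → x ∈ A → ∃ λ x′ → x′ ∈ X × d x′ x ≤ℚ R + R) ×
                       ∣ X ∣ ℕ.+ ∣ X ∣ ℕ.≤ ∣ B ∣
  half-cover with select (allFin n)
  ... | S , covers = X S , X⊆A S , (λ x → covers (∈-allFin x)) ,
                     ℕP.≤-trans (∣X∣+∣X∣≤∣Y∣ S) (p⊆q⇒∣p∣≤∣q∣ (Y⊆B S))

module Geometry (G : Graph) (st : Standing G) where

  open Graph G
  open Standing st

  plen-cons : ∀ {u x v t} → Walk G x v t → plen G (u ∷ t) ≡ w u x + plen G t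
  plen-cons nil        = refl
  plen-cons (cons _ _) = refl

  plen-nonNeg : ∀ {u v p} → Walk G u v p → 0ℚ ≤ℚ plen G p
  plen-nonNeg nil = ℚP.≤-refl
  plen-nonNeg (cons e rest) = subst (0ℚ ≤ℚ_) (sym (plen-cons rest))
    (+-nonNeg (ℚP.≤-trans (toWitness {a? = 0ℚ ℚP.≤? 1ℚ} _) (w-≥1 e)) (plen-nonNeg rest))

  walk-++ : ∀ {a b c p q} → Walk G a b p → Walk G b c q →
            ∃ λ t → Walk G a c t × plen G t ≡ plen G p + plen G q
  walk-++ nil q = _ , q , sym (ℚP.+-identityˡ _)
  walk-++ {a} {q = q} (cons {x = x} {p = p} e rest) wq with walk-++ rest wq
  ... | t , wt , eq = a ∷ t , cons e wt , (begin
    plen G (a ∷ t)                   ≡⟨ plen-cons wt ⟩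
    w a x + plen G t                 ≡⟨ cong (λ s → w a x + s) eq ⟩
    w a x + (plen G p + plen G q)    ≡⟨ ℚP.+-assoc (w a x) _ _ ⟨
    (w a x + plen G p) + plen G q    ≡⟨ cong (_+ plen G q) (plen-cons rest) ⟨
    plen G (a ∷ p) + plen G q        ∎)
    where open ≡-Reasoning

  walk-reverse : ∀ {a b p} → Walk G a b p → ∃ λ t → Walk G b a t × plen G t ≡ plen G p
  walk-reverse nil = _ , nil , refl
  walk-reverse (cons {u = u} {x = x} {p = p} e rest) with walk-reverse rest
  ... | t , wt , eq with walk-++ wt (cons (E-sym e) nil)
  ... | t′ , wt′ , eq′ = t′ , wt′ , (begin
    plen G t′                  ≡⟨ eq′ ⟩
    plen G t + (w x u + 0ℚ)    ≡⟨ cong₂ _+_ eq (trans (ℚP.+-identityʳ _) (w-sym x u)) ⟩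
    plen G p + w u x           ≡⟨ ℚP.+-comm (plen G p) (w u x) ⟩
    w u x + plen G p           ≡⟨ plen-cons rest ⟨
    plen G (u ∷ p)             ∎)
    where open ≡-Reasoning

  sp-walk : ∀ a b → Walk G a b (sp a b)
  sp-walk a b = proj₁ (sp-shortest a b)

  dist≤plen : ∀ {a b q} → Walk G a b q → dist G a b ≤ℚ plen G q
  dist≤plen {a} {b} = proj₂ (sp-shortest a b) _

  dist-nonNeg : ∀ a b → 0ℚ ≤ℚ dist G a b
  dist-nonNeg a b = plen-nonNeg (sp-walk a b)

  dist-self : ∀ a → dist G a a ≤ℚ 0ℚ
  dist-self a = dist≤plen nil

  dist-triangle : ∀ a b c → dist G a c ≤ℚ dist G a b + dist G b c
  dist-triangle a b c with walk-++ (sp-walk a b) (sp-walk b c)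
  ... | t , wt , eq = ℚP.≤-trans (dist≤plen wt) (ℚP.≤-reflexive eq)

  dist-sym : ∀ a b → dist G a b ≡ dist G b a
  dist-sym a b = ℚP.≤-antisym (≤-reversed b a) (≤-reversed a b)
    where
    ≤-reversed : ∀ a b → dist G b a ≤ℚ dist G a b
    ≤-reversed a b with walk-reverse (sp-walk a b)
    ... | t , wt , eq = ℚP.≤-trans (dist≤plen wt) (ℚP.≤-reflexive eq)

  walk-split : ∀ {a b} pre z post → Walk G a b (pre ++ z ∷ post) →
               Walk G a z (pre ++ [ z ]) × Walk G z b (z ∷ post)
  walk-split []            z post nil           = nil , nil
  walk-split []            z post (cons e rest) = nil , cons e rest
  walk-split (_ ∷ [])      z post (cons e rest) with walk-split [] z post rest
  ... | left , right = cons e left , right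
  walk-split (_ ∷ h ∷ pre) z post (cons e rest) with walk-split (h ∷ pre) z post rest
  ... | left , right = cons e left , right

  plen-split : ∀ pre z post → plen G (pre ++ z ∷ post) ≡ plen G (pre ++ [ z ]) + plen G (z ∷ post)
  plen-split []            z post = sym (ℚP.+-identityˡ _)
  plen-split (h ∷ [])      z post = cong (_+ plen G (z ∷ post)) (sym (ℚP.+-identityʳ (w h z)))
  plen-split (h ∷ h′ ∷ pre) z post = trans (cong (λ s → w h h′ + s) (plen-split (h′ ∷ pre) z post))
    (sym (ℚP.+-assoc (w h h′) (plen G ((h′ ∷ pre) ++ [ z ])) (plen G (z ∷ post))))

  shortest-split : ∀ {a b} pre z post → IsShortestWalk G a b (pre ++ z ∷ post) →
                   IsShortestWalk G a z (pre ++ [ z ]) × IsShortestWalk G z b (z ∷ post)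
  shortest-split {a} {b} pre z post (walk , minimal) = (left , left-minimal) , (right , right-minimal)
    where
    left : Walk G a z (pre ++ [ z ])
    left = proj₁ (walk-split pre z post walk)
    right : Walk G z b (z ∷ post)
    right = proj₂ (walk-split pre z post walk)
    whole-≤ : ∀ {t} → Walk G a b t → plen G (pre ++ [ z ]) + plen G (z ∷ post) ≤ℚ plen G t
    whole-≤ wt = subst (_≤ℚ _) (plen-split pre z post) (minimal _ wt)
    left-minimal : ∀ q → Walk G a z q → plen G (pre ++ [ z ]) ≤ℚ plen G q
    left-minimal q wq with walk-++ wq right
    ... | t , wt , eq = +-cancelʳ-≤ (plen G (z ∷ post)) (subst (_ ≤ℚ_) eq (whole-≤ wt))
    right-minimal : ∀ q → Walk G z b q → plen G (z ∷ post) ≤ℚ plen G q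
    right-minimal q wq with walk-++ left wq
    ... | t , wt , eq = +-cancelˡ-≤ (plen G (pre ++ [ z ])) (subst (_ ≤ℚ_) eq (whole-≤ wt))

  sp-split : ∀ {a b} pre z post → sp a b ≡ pre ++ z ∷ post →
             sp a z ≡ pre ++ [ z ] × sp z b ≡ z ∷ post
  sp-split {a} {b} pre z post eq with shortest-split pre z post (subst (IsShortestWalk G a b) eq (sp-shortest a b))
  ... | left , right = sym (sp-unique a z _ left) , sym (sp-unique z b _ right)

  dist-split : ∀ {a b} pre z post → sp a b ≡ pre ++ z ∷ post → dist G a b ≡ dist G a z + dist G z b
  dist-split {a} {b} pre z post eq with sp-split pre z post eq
  ... | left , right = begin
    plen G (sp a b)                               ≡⟨ cong (plen G) eq ⟩
    plen G (pre ++ z ∷ post)                      ≡⟨ plen-split pre z post ⟩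
    plen G (pre ++ [ z ]) + plen G (z ∷ post)     ≡⟨ cong₂ _+_ (cong (plen G) left) (cong (plen G) right) ⟨
    plen G (sp a z) + plen G (sp z b)             ∎
    where open ≡-Reasoning

  walk-length≥2 : ∀ {u v p} → Walk G u v p → u ≢ v → 2 ℕ.≤ length p
  walk-length≥2 nil                u≢u = ⊥-elim (u≢u refl)
  walk-length≥2 (cons _ nil)       _   = s≤s (s≤s z≤n)
  walk-length≥2 (cons _ (cons _ _)) _  = s≤s (s≤s z≤n)

  module Shortcut (P : Subset n) (r : ℚ) where

    SW : Fin n → Fin n → List (Fin n) → Set
    SW = SWalk G P r

    slen-cons : ∀ {u x v t} → SW x v t → slen G (u ∷ t) ≡ dist G u x + slen G t
    slen-cons (nil _)    = refl
    slen-cons (cons _ _) = refl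

    swalk-head : ∀ {a b p} → SW a b p → a ∈ P
    swalk-head (nil a∈P)              = a∈P
    swalk-head (cons (a∈P , _) _) = a∈P

    dist≤slen : ∀ {a b p} → SW a b p → dist G a b ≤ℚ slen G p
    dist≤slen {a} (nil _) = dist-self a
    dist≤slen {a} {b} (cons {x = x} {p = p} e rest) = begin
      dist G a b                ≤⟨ dist-triangle a x b ⟩
      dist G a x + dist G x b   ≤⟨ ℚP.+-monoʳ-≤ (dist G a x) (dist≤slen rest) ⟩
      dist G a x + slen G p     ≡⟨ slen-cons rest ⟨
      slen G (a ∷ p)            ∎
      where open ℚP.≤-Reasoning

    record Split (a m b : Fin n) (q : List (Fin n)) : Set where
      constructor split
      field
        {left right} : List (Fin n)
        left-walk    : SW a m left
        right-walk   : SW m b right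
        slen-split   : slen G q ≡ slen G left + slen G right

    open Split

    split-head : ∀ {a b q} → SW a b q → Split a a b q
    split-head wq = split (nil (swalk-head wq)) wq (sym (ℚP.+-identityˡ _))

    split-cons : ∀ {u x m b t} → SEdge G P r u x → SW x b t → Split x m b t → Split u m b (u ∷ t)
    split-cons {u} {x} {t = t} e wt (split {left} {right} wl wr eq) = split (cons e wl) wr (begin
      slen G (u ∷ t)                                ≡⟨ slen-cons wt ⟩
      dist G u x + slen G t                         ≡⟨ cong (λ s → dist G u x + s) eq ⟩
      dist G u x + (slen G left + slen G right)     ≡⟨ ℚP.+-assoc (dist G u x) _ _ ⟨
      (dist G u x + slen G left) + slen G right     ≡⟨ cong (_+ slen G right) (slen-cons wl) ⟨
      slen G (u ∷ left) + slen G right              ∎)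
      where open ≡-Reasoning

    split-at : ∀ {a b q m} → SW a b q → m ∈ₗ q → Split a m b q
    split-at wq@(nil _)      (here refl) = split-head wq
    split-at wq@(cons _ _)   (here refl) = split-head wq
    split-at (cons e rest) (there m∈q) = split-cons e rest (split-at rest m∈q)

    swalk-++ : ∀ {a b c p q} → SW a b p → SW b c q →
               ∃ λ t → SW a c t × slen G t ≡ slen G p + slen G q
    swalk-++ (nil _) wq = _ , wq , sym (ℚP.+-identityˡ _)
    swalk-++ {a} (cons e rest) wq with swalk-++ rest wq
    ... | t , wt , eq = a ∷ t , cons e wt , slen-split (split-cons e wt (split rest wq eq))

    sedge-≤ : ∀ {a b} → SEdge G P r a b → dist G a b ≤ℚ r
    sedge-≤ (_ , _ , _ , a-b≤r , _) = a-b≤r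

    suffix-window : ∀ {a b q} t → 0ℚ ≤ℚ t → SW a b q → t < slen G q →
                    ∃ λ m → Σ (Split a m b q) λ s → t < slen G (right s) × slen G (right s) ≤ℚ t + r
    suffix-window t t≥0 (nil _) t<0 = ⊥-elim (<⇒≱ t<0 t≥0)
    suffix-window t t≥0 (cons {x = x} {p = p} e rest) t<q with t ℚP.<? slen G p
    ... | yes t<p = let m , s , bounds = suffix-window t t≥0 rest t<p in m , split-cons e rest s , bounds
    ... | no t≮p  = _ , split-head (cons e rest) , t<q , (begin
      slen G (_ ∷ p)           ≡⟨ slen-cons rest ⟩
      dist G _ x + slen G p    ≤⟨ ℚP.+-mono-≤ (sedge-≤ e) (ℚP.≮⇒≥ t≮p) ⟩
      r + t                    ≡⟨ ℚP.+-comm r t ⟩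
      t + r                    ∎)
      where open ℚP.≤-Reasoning

    prefix-window-from : ∀ {a b q} offset t → offset ≤ℚ t → SW a b q → t < offset + slen G q →
                         ∃ λ m → Σ (Split a m b q) λ s →
                           t < offset + slen G (left s) × offset + slen G (left s) ≤ℚ t + r
    prefix-window-from offset t offset≤t (nil _) t<offset+0 =
      ⊥-elim (<⇒≱ t<offset+0 (subst (_≤ℚ t) (sym (ℚP.+-identityʳ offset)) offset≤t))
    prefix-window-from {a} offset t offset≤t (cons {x = x} {p = p} e rest) t<offset+q
      with t ℚP.<? offset + dist G a x
    ... | yes t<offset+e = x , split-cons e rest (split-head rest) ,
          subst (λ s → t < offset + s) (sym (ℚP.+-identityʳ _)) t<offset+e ,
          subst (λ s → offset + s ≤ℚ t + r) (sym (ℚP.+-identityʳ _)) (ℚP.+-mono-≤ offset≤t (sedge-≤ e))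
    ... | no t≮offset+e
      with prefix-window-from (offset + dist G a x) t (ℚP.≮⇒≥ t≮offset+e) rest
             (subst (t <_) (trans (cong (λ s → offset + s) (slen-cons rest)) (sym (ℚP.+-assoc offset _ _))) t<offset+q)
    ...   | m , s , lower , upper = m , split-cons e rest s ,
            subst (t <_) reassoc lower , subst (_≤ℚ t + r) reassoc upper
      where
      reassoc : offset + dist G a x + slen G (left s) ≡ offset + slen G (a ∷ left s)
      reassoc = trans (ℚP.+-assoc offset _ _) (cong (λ s → offset + s) (sym (slen-cons (left-walk s))))

    prefix-window : ∀ {a b q} t → 0ℚ ≤ℚ t → SW a b q → t < slen G q →
                    ∃ λ m → Σ (Split a m b q) λ s → t < slen G (left s) × slen G (left s) ≤ℚ t + r
    prefix-window t t≥0 wq t<q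
      with prefix-window-from 0ℚ t t≥0 wq (subst (t <_) (sym (ℚP.+-identityˡ _)) t<q)
    ... | m , s , lower , upper =
      m , s , subst (t <_) (ℚP.+-identityˡ _) lower , subst (_≤ℚ t + r) (ℚP.+-identityˡ _) upper

    segment-minimal : ∀ {v v′ q m₁ m₂ A S C W} → IsShortestSWalk G P r v v′ q →
                      SW v m₁ A → SW m₁ m₂ S → SW m₂ v′ C →
                      slen G q ≡ (slen G A + slen G S) + slen G C →
                      SW m₁ m₂ W → slen G S ≤ℚ slen G W
    segment-minimal {q = q} {A = A} {S} {C} {W} (_ , minimal) wA wS wC q≡ASC wW
      with swalk-++ wA wW
    ... | AW , wAW , AW≡ with swalk-++ wAW wC
    ... | AWC , wAWC , AWC≡ =
      +-cancelˡ-≤ (slen G A) (+-cancelʳ-≤ (slen G C) (begin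
        (slen G A + slen G S) + slen G C   ≡⟨ q≡ASC ⟨
        slen G q                           ≤⟨ minimal AWC wAWC ⟩
        slen G AWC                         ≡⟨ trans AWC≡ (cong (_+ slen G C) AW≡) ⟩
        (slen G A + slen G W) + slen G C   ∎))
      where open ℚP.≤-Reasoning

    interior? : ∀ a b xs → (∀ z → z ∈ₗ xs → z ∈ P → z ≡ a ⊎ z ≡ b) ⊎
                           (∃ λ z → z ∈ₗ xs × z ∈ P × z ≢ a × z ≢ b)
    interior? a b xs with any? (λ z → z ∈? P ×-dec ¬? (z ≟ᶠ a) ×-dec ¬? (z ≟ᶠ b)) xs
    ... | yes found = inj₂ (find found)
    ... | no none   = inj₁ endpoint
      where
      endpoint : ∀ z → z ∈ₗ xs → z ∈ P → z ≡ a ⊎ z ≡ b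
      endpoint z z∈xs z∈P with z ≟ᶠ a | z ≟ᶠ b
      ... | yes z≡a | _       = inj₁ z≡a
      ... | no _    | yes z≡b = inj₂ z≡b
      ... | no z≢a  | no z≢b  = ⊥-elim (none (lose z∈xs (z∈P , z≢a , z≢b)))

    ShortcutWithin : Fin n → Fin n → ℚ → Set
    ShortcutWithin a b s = ∃ λ W → SW a b W × slen G W ≤ℚ s

    within-++ : ∀ {a z b s₁ s₂} → ShortcutWithin a z s₁ → ShortcutWithin z b s₂ → ShortcutWithin a b (s₁ + s₂)
    within-++ (W₁ , w₁ , W₁≤) (W₂ , w₂ , W₂≤) with swalk-++ w₁ w₂
    ... | W , wW , W≡ = W , wW , ℚP.≤-trans (ℚP.≤-reflexive W≡) (ℚP.+-mono-≤ W₁≤ W₂≤)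

    within-mono : ∀ {a b s t} → ShortcutWithin a b s → s ≤ℚ t → ShortcutWithin a b t
    within-mono (W , wW , W≤s) s≤t = W , wW , ℚP.≤-trans W≤s s≤t

    shortcut-walk : ∀ {a b} → a ∈ P → b ∈ P → dist G a b ≤ℚ r → ShortcutWithin a b (dist G a b)
    shortcut-walk {a} {b} = go (suc (length (sp a b))) ℕP.≤-refl
      where
      piece< : ∀ {A B L k} → A ℕ.+ B ≡ suc L → 2 ℕ.≤ B → L ℕ.< suc k → A ℕ.< k
      piece< {A} {B} {L} {k} A+B≡1+L 2≤B L<1+k = ℕP.≤-pred (begin
        2 ℕ.+ A    ≡⟨ ℕP.+-comm 2 A ⟩
        A ℕ.+ 2    ≤⟨ ℕP.+-monoʳ-≤ A 2≤B ⟩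
        A ℕ.+ B    ≡⟨ A+B≡1+L ⟩
        suc L      ≤⟨ L<1+k ⟩
        suc k      ∎)
        where open ℕP.≤-Reasoning
      -- An interior vertex of P splits sp a b into two strictly shorter shortest paths.
      go : ∀ {a b} k → length (sp a b) ℕ.< k → a ∈ P → b ∈ P → dist G a b ≤ℚ r →
           ShortcutWithin a b (dist G a b)
      go {a} {b} (suc k) len< a∈P b∈P a-b≤r with interior? a b (sp a b)
      ... | inj₁ endpoints with a ≟ᶠ b
      ...   | yes refl = a ∷ [] , nil a∈P , dist-nonNeg a a
      ...   | no a≢b   = a ∷ b ∷ [] , cons (a∈P , b∈P , a≢b , a-b≤r , endpoints) (nil b∈P) ,
                         ℚP.≤-reflexive (ℚP.+-identityʳ _)
      go {a} {b} (suc k) len< a∈P b∈P a-b≤r | inj₂ (z , z∈sp , z∈P , z≢a , z≢b)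
        with ∈-∃++ z∈sp
      ... | pre , post , sp≡ with sp-split pre z post sp≡
      ... | sp-az≡ , sp-zb≡ =
        subst (ShortcutWithin a b) (sym a-b≡) (within-++ (go k a-z-len< a∈P z∈P a-z≤r) (go k z-b-len< z∈P b∈P z-b≤r))
        where
        a-b≡ : dist G a b ≡ dist G a z + dist G z b
        a-b≡ = dist-split pre z post sp≡
        a-z≤r : dist G a z ≤ℚ r
        a-z≤r = ℚP.≤-trans (subst (dist G a z ≤ℚ_) (sym a-b≡) (≤-+ʳ (dist G a z) (dist-nonNeg z b))) a-b≤r
        z-b≤r : dist G z b ≤ℚ r
        z-b≤r = ℚP.≤-trans (subst (dist G z b ≤ℚ_) (trans (ℚP.+-comm (dist G z b) (dist G a z)) (sym a-b≡))
                                  (≤-+ʳ (dist G z b) (dist-nonNeg a z))) a-b≤r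
        lengths : length (sp a z) ℕ.+ length (sp z b) ≡ suc (length (sp a b))
        lengths = trans (cong₂ ℕ._+_ (cong length sp-az≡) (cong length sp-zb≡))
                        (trans (sym (length-split pre z post)) (cong (suc ∘ length) (sym sp≡)))
        a-z-len< : length (sp a z) ℕ.< k
        a-z-len< = piece< lengths (walk-length≥2 (sp-walk z b) z≢b) len<
        z-b-len< : length (sp z b) ℕ.< k
        z-b-len< = piece< (trans (ℕP.+-comm (length (sp z b)) (length (sp a z))) lengths)
                          (walk-length≥2 (sp-walk a z) (z≢a ∘ sym)) len<

    detour : ∀ {y m₁ m₂} → y ∈ P → m₁ ∈ P → m₂ ∈ P → dist G y m₁ ≤ℚ r → dist G y m₂ ≤ℚ r →
             ShortcutWithin m₁ m₂ (r + r)
    detour {y} {m₁} y∈P m₁∈P m₂∈P y-m₁≤r y-m₂≤r = within-++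
      (within-mono (shortcut-walk m₁∈P y∈P m₁-y≤r) m₁-y≤r) (within-mono (shortcut-walk y∈P m₂∈P y-m₂≤r) y-m₂≤r)
      where
      m₁-y≤r : dist G m₁ y ≤ℚ r
      m₁-y≤r = subst (_≤ℚ r) (dist-sym y m₁) y-m₁≤r

    segment-≤-detour : ∀ {v v′ q m₁ m₂ A S C y} → IsShortestSWalk G P r v v′ q →
                       SW v m₁ A → SW m₁ m₂ S → SW m₂ v′ C →
                       slen G q ≡ (slen G A + slen G S) + slen G C →
                       y ∈ P → dist G y m₁ ≤ℚ r → dist G y m₂ ≤ℚ r → slen G S ≤ℚ r + r
    segment-≤-detour shortest wA wS wC q≡ASC y∈P y-m₁≤r y-m₂≤r
      with detour y∈P (swalk-head wS) (swalk-head wC) y-m₁≤r y-m₂≤r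
    ... | W , wW , W≤2r = ℚP.≤-trans (segment-minimal shortest wA wS wC q≡ASC wW) W≤2r

    module _ {B : Subset n} (B-covers : IsBallCover G P r B) (r≥0 : 0ℚ ≤ℚ r) where

      2r≥0 : 0ℚ ≤ℚ r + r
      2r≥0 = +-nonNeg r≥0 r≥0

      r+3r≡4r : r + ((r + r) + r) ≡ (r + r) + (r + r)
      r+3r≡4r = solve 1 (λ r → r :+ ((r :+ r) :+ r) := (r :+ r) :+ (r :+ r)) refl r
        where open +-*-Solver

      far-pair-doubly-covered : ∀ {x z} → x ∈ P → z ∈ P → dist G z x ≤ℚ (r + r) + r →
        (∀ {y} → y ∈ P → dist G y z ≤ℚ r → dist G y x ≤ℚ r → ⊥) →
        DoublyCovered (dist G) B ((r + r) + (r + r)) x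
      far-pair-doubly-covered {x} {z} x∈P z∈P z-x≤3r no-common-centre
        with proj₂ B-covers x x∈P | proj₂ B-covers z z∈P
      ... | y₀ , y₀∈B , y₀-x≤r | y₁ , y₁∈B , y₁-z≤r =
        doublyCovered y₀∈B y₁∈B y₀≢y₁ y₀-x≤4r y₁-x≤4r
        where
        open ℚP.≤-Reasoning
        y₀≢y₁ : y₀ ≢ y₁
        y₀≢y₁ refl = no-common-centre (proj₁ B-covers y₀∈B) y₁-z≤r y₀-x≤r
        y₀-x≤4r : dist G y₀ x ≤ℚ (r + r) + (r + r)
        y₀-x≤4r = begin
          dist G y₀ x             ≤⟨ y₀-x≤r ⟩
          r                       ≤⟨ ≤-+ʳ r (+-nonNeg 2r≥0 r≥0) ⟩
          r + ((r + r) + r)       ≡⟨ r+3r≡4r ⟩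
          (r + r) + (r + r)       ∎
        y₁-x≤4r : dist G y₁ x ≤ℚ (r + r) + (r + r)
        y₁-x≤4r = begin
          dist G y₁ x                  ≤⟨ dist-triangle y₁ z x ⟩
          dist G y₁ z + dist G z x     ≤⟨ ℚP.+-mono-≤ y₁-z≤r z-x≤3r ⟩
          r + ((r + r) + r)            ≡⟨ r+3r≡4r ⟩
          (r + r) + (r + r)            ∎

      long-shortcut-doubly-covered : ∀ {v v′ q x} → IsShortestSWalk G P r v v′ q →
        (r + r) + (r + r) < slen G q → x ∈ₗ q → DoublyCovered (dist G) B ((r + r) + (r + r)) x
      long-shortcut-doubly-covered shortest 4r<q x∈q with split-at (proj₁ shortest) x∈q
      ... | split {q₁} {q₂} w₁ w₂ q≡ with (r + r) ℚP.<? slen G q₁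
      ... | yes 2r<q₁ with suffix-window (r + r) 2r≥0 w₁ 2r<q₁
      ...   | _ , split wA wS q₁≡ , 2r<S , S≤3r =
        far-pair-doubly-covered (swalk-head w₂) (swalk-head wS) (ℚP.≤-trans (dist≤slen wS) S≤3r)
          λ y∈P y-z≤r y-x≤r → <⇒≱ 2r<S
            (segment-≤-detour shortest wA wS w₂ (trans q≡ (cong (_+ slen G q₂) q₁≡)) y∈P y-z≤r y-x≤r)
      long-shortcut-doubly-covered {q = q} shortest 4r<q x∈q | split {q₁} {q₂} w₁ w₂ q≡ | no 2r≮q₁
        with prefix-window (r + r) 2r≥0 w₂ (<-of-sum (subst ((r + r) + (r + r) <_) q≡ 4r<q) (ℚP.≮⇒≥ 2r≮q₁))
      ... | z , split {S} {C} wS wC q₂≡ , 2r<S , S≤3r =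
        far-pair-doubly-covered (swalk-head w₂) (swalk-head wC)
          (ℚP.≤-trans (ℚP.≤-reflexive (dist-sym z _)) (ℚP.≤-trans (dist≤slen wS) S≤3r))
          λ y∈P y-z≤r y-x≤r → <⇒≱ 2r<S
            (segment-≤-detour shortest w₁ wS wC q≡q₁SC y∈P y-x≤r y-z≤r)
        where
        q≡q₁SC : slen G q ≡ (slen G q₁ + slen G S) + slen G C
        q≡q₁SC = trans q≡ (trans (cong (λ s → slen G q₁ + s) q₂≡) (sym (ℚP.+-assoc (slen G q₁) (slen G S) (slen G C))))

pow8-pos : ∀ j → 0ℚ < pow8 j
pow8-pos j = fromℕ-mono-< (ℕP.m^n>0 8 j)

pow8prev-suc : ∀ j → pow8prev (suc j) ≡ pow8 j
pow8prev-suc j = /-cross (8 ^ suc j) 7 (8 ^ j) 0 (trans (ℕP.*-identityʳ _) (ℕP.*-comm 8 (8 ^ j)))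

module _ (j : ℕ) where

  private
    m : ℕ
    m = 8 ^ j
    r : ℚ
    r = pow8 j

  4×pow8 : (r + r) + (r + r) ≡ fromℕ (4 ℕ.* m)
  4×pow8 = begin
    (r + r) + (r + r)                  ≡⟨ cong₂ _+_ (fromℕ-+ m m) (fromℕ-+ m m) ⟨
    fromℕ (m ℕ.+ m) + fromℕ (m ℕ.+ m)   ≡⟨ fromℕ-+ (m ℕ.+ m) (m ℕ.+ m) ⟨
    fromℕ ((m ℕ.+ m) ℕ.+ (m ℕ.+ m))     ≡⟨ cong fromℕ (quadruple m) ⟩
    fromℕ (4 ℕ.* m)                    ∎
    where
    open ≡-Reasoning
    quadruple : ∀ m → (m ℕ.+ m) ℕ.+ (m ℕ.+ m) ≡ 4 ℕ.* m
    quadruple = solve-∀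

  4×pow8<threeQuarterPow8 : (r + r) + (r + r) < threeQuarterPow8 (suc j)
  4×pow8<threeQuarterPow8 = begin-strict
    (r + r) + (r + r)         ≡⟨ 4×pow8 ⟩
    fromℕ (4 ℕ.* m)           <⟨ fromℕ-mono-< (ℕP.*-monoˡ-< m {{ℕP.m^n≢0 8 j}} (ℕP.m<n+m 4 {2} ℕ.z<s)) ⟩
    fromℕ (6 ℕ.* m)           ≡⟨ /-cross (3 ℕ.* (8 ℕ.* m)) 3 (6 ℕ.* m) 0 (times m) ⟨
    threeQuarterPow8 (suc j)  ∎
    where
    open ℚP.≤-Reasoning
    times : ∀ m → 3 ℕ.* (8 ℕ.* m) ℕ.* 1 ≡ 6 ℕ.* m ℕ.* 4
    times = solve-∀

  8×pow8 : ((r + r) + (r + r)) + ((r + r) + (r + r)) ≡ pow8 (suc j)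
  8×pow8 = begin
    ((r + r) + (r + r)) + ((r + r) + (r + r))   ≡⟨ cong₂ _+_ 4×pow8 4×pow8 ⟩
    fromℕ (4 ℕ.* m) + fromℕ (4 ℕ.* m)           ≡⟨ fromℕ-+ (4 ℕ.* m) (4 ℕ.* m) ⟨
    fromℕ (4 ℕ.* m ℕ.+ 4 ℕ.* m)                 ≡⟨ cong fromℕ (ℕP.*-distribʳ-+ m 4 4) ⟨
    pow8 (suc j)                               ∎
    where open ≡-Reasoning

double≤⇒≤half : ∀ {a b} → a ℕ.+ a ℕ.≤ b → fromℕ a ≤ℚ ½ * fromℕ b
double≤⇒≤half {a} {b} a+a≤b = begin
  fromℕ a                       ≡⟨ solve 1 (λ x → x := con ½ :* (x :+ x)) refl (fromℕ a) ⟩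
  ½ * (fromℕ a + fromℕ a)       ≡⟨ cong (½ *_) (fromℕ-+ a a) ⟨
  ½ * fromℕ (a ℕ.+ a)           ≤⟨ ℚP.*-monoˡ-≤-nonNeg ½ (fromℕ-mono-≤ a+a≤b) ⟩
  ½ * fromℕ b                   ∎
  where
  open ℚP.≤-Reasoning
  open +-*-Solver

module _ (G : Graph) where

  open Graph G

  OnLongShortcut : Subset n → ℕ → Fin n → Set
  OnLongShortcut P i x = ∃ λ v → ∃ λ v′ → ∃ λ q →
    IsShortestSWalk G P (pow8prev i) v v′ q × threeQuarterPow8 i ≤ℚ slen G q × x ∈ₗ q

  added-on-long : ∀ {P i v v′ q z} → Qualifies G P i v v′ → IsShortestSWalk G P (pow8prev i) v v′ q →
                  ClosestToMid G q z → OnLongShortcut P i z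
  added-on-long {i = i} {q = q} (_ , _ , (q′ , shortest′ , long′ , _) , _) shortest (k , q[k]≡z , _) =
    _ , _ , q , shortest , ℚP.≤-trans {threeQuarterPow8 i} {slen G q′} {slen G q} long′ (proj₂ shortest′ q (proj₁ shortest)) ,
    subst (_∈ₗ q) q[k]≡z (∈-lookup k)

  run-⊆ : ∀ {P i S ps T x} → Run G P i S ps T → x ∈ T → x ∈ S ⊎ OnLongShortcut P i x
  run-⊆ done                     x∈T = inj₁ x∈T
  run-⊆ (skip _ run)             x∈T = run-⊆ run x∈T
  run-⊆ (hit _ _ _ _ run)        x∈T = run-⊆ run x∈T
  run-⊆ {P} {i} (add _ _ qualifies shortest _ closest run) x∈T =
    [ [ inj₁ , (λ { refl → inj₂ (added-on-long {P} {i} qualifies shortest closest) }) ]′ ∘ x∈p∪⁅y⁆⁻ , inj₂ ]′ (run-⊆ run x∈T)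

  valid-level : ∀ {P i S x} → ValidC'Level G P i S → x ∈ S → OnLongShortcut P i x
  valid-level (_ , _ , run) x∈S = [ ⊥-elim ∘ ∉⊥ , id ]′ (run-⊆ run x∈S)

  light-level : ∀ {U C′ C} → IsMaxEdgeWeight G U → ValidHierarchy G C′ C →
                ∀ j → U ≤ℚ pow8 j → C (suc j) ⊆ C′ (suc j)
  light-level {U} (_ , ≤U) (C-def , _) j U≤ {x} x∈C =
    [ id , (λ (y , e , heavy) → ⊥-elim (<⇒≱ heavy (w≤pow8prev y e))) ]′ (Equivalence.to (C-def (suc j) x) x∈C)
    where
    w≤pow8prev : ∀ y → E x y → w x y ≤ℚ pow8prev (suc j)
    w≤pow8prev y e = begin
      w x y               ≤⟨ ≤U x y e ⟩
      U                   ≤⟨ U≤ ⟩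
      pow8 j              ≡⟨ pow8prev-suc j ⟨
      pow8prev (suc j)    ∎
      where open ℚP.≤-Reasoning

level-doubly-covered : ∀ {G} → Standing G → ∀ {U C′ C} → IsMaxEdgeWeight G U → ValidHierarchy G C′ C →
  ∀ j → U ≤ℚ pow8 j → ∀ {B′} → IsBallCover G (C j) (pow8 j) B′ →
  ∀ {x} → x ∈ C (suc j) → DoublyCovered (dist G) B′ ((pow8 j + pow8 j) + (pow8 j + pow8 j)) x
level-doubly-covered {G} st {C′ = C′} {C} max-U hierarchy j U≤ {B′} B′-covers {x} x∈C =
  doubly (valid-level G {C j} {suc j} {C′ (suc j)} (proj₂ hierarchy (suc j)) (light-level G max-U hierarchy j U≤ x∈C))
  where
  open Geometry.Shortcut G st (C j) (pow8 j)
  doubly : OnLongShortcut G (C j) (suc j) x → DoublyCovered (dist G) B′ ((pow8 j + pow8 j) + (pow8 j + pow8 j)) x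
  doubly (v , v′ , q , shortest , long , x∈q) =
    long-shortcut-doubly-covered B′-covers (ℚP.<⇒≤ (pow8-pos j))
      (subst (λ r → IsShortestSWalk G (C j) r v v′ q) (pow8prev-suc j) shortest)
      (ℚP.<-≤-trans {_} {threeQuarterPow8 (suc j)} {slen G q} (4×pow8<threeQuarterPow8 j) long) x∈q

ballCover-halves : ∀ {G} → Standing G → ∀ {U C′ C} → IsMaxEdgeWeight G U → ValidHierarchy G C′ C →
  ∀ j → U ≤ℚ pow8 j → ∀ {B B′} →
  IsMinBallCover G (C (suc j)) (pow8 (suc j)) B → IsMinBallCover G (C j) (pow8 j) B′ →
  ∣ B ∣ ℕ.+ ∣ B ∣ ℕ.≤ ∣ B′ ∣
ballCover-halves {G} st {C = C} max-U hierarchy j U≤ {B} {B′} (_ , B-minimal) (B′-covers , _) =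
  from-half-cover (HalfCover.half-cover (dist G) (Geometry.dist-sym G st) (Geometry.dist-triangle G st)
                     (C (suc j)) B′ 4r (level-doubly-covered st max-U hierarchy j U≤ B′-covers))
  where
  4r : ℚ
  4r = (pow8 j + pow8 j) + (pow8 j + pow8 j)
  from-half-cover : (∃ λ X → X ⊆ C (suc j) × (∀ x → x ∈ C (suc j) → ∃ λ x′ → x′ ∈ X × dist G x′ x ≤ℚ 4r + 4r) ×
                             ∣ X ∣ ℕ.+ ∣ X ∣ ℕ.≤ ∣ B′ ∣) →
                    ∣ B ∣ ℕ.+ ∣ B ∣ ℕ.≤ ∣ B′ ∣
  from-half-cover (X , X⊆C , X-covers , ∣X∣+∣X∣≤∣B′∣) = ℕP.≤-trans (ℕP.+-mono-≤ ∣B∣≤∣X∣ ∣B∣≤∣X∣) ∣X∣+∣X∣≤∣B′∣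
    where
    X-ballCover : IsBallCover G (C (suc j)) (pow8 (suc j)) X
    X-ballCover = X⊆C , λ x x∈C → let x′ , x′∈X , near = X-covers x x∈C in
                                  x′ , x′∈X , subst (dist G x′ x ≤ℚ_) (8×pow8 j) near
    ∣B∣≤∣X∣ : ∣ B ∣ ℕ.≤ ∣ X ∣
    ∣B∣≤∣X∣ = B-minimal X X-ballCover

mainTheorem12 : (h : ℕ) → Σ ℚ λ c → (0ℚ < c × c < 1ℚ) ×
    ((G : Graph) → Standing G → HighwayDimLE G h →
     (U : ℚ) → IsMaxEdgeWeight G U →
     (C' C : ℕ → Subset (Graph.n G)) → ValidHierarchy G C' C →
     (i : ℕ) → 1 ≤ i → U ≤ℚ pow8 (i ∸ 1) →
     (B B' : Subset (Graph.n G)) →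
     IsMinBallCover G (C i) (pow8 i) B →
     IsMinBallCover G (C (i ∸ 1)) (pow8 (i ∸ 1)) B' →
     (+ ∣ B ∣) / 1 ≤ℚ c * ((+ ∣ B' ∣) / 1))
mainTheorem12 h = ½ , (toWitness {a? = 0ℚ ℚP.<? ½} _ , toWitness {a? = ½ ℚP.<? 1ℚ} _) ,
  λ { G st _ U max-U C′ C hierarchy (suc j) _ U≤ B B′ B-minimal B′-minimal →
        double≤⇒≤half {∣ B ∣} {∣ B′ ∣} (ballCover-halves st max-U hierarchy j U≤ B-minimal B′-minimal)
    ; _ _ _ _ _ _ _ _ zero () }
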